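{- Let $\mathcal{H}$ be a class of hypergraphs. If $\mathcal{H}$ has bounded fractional edge-cover number, then $\mathcal{Q}(\mathcal{S}(\mathcal{H}))$ has bounded fractional hypertree width. If instead $\mathcal{H}$ has unbounded fractional edge-cover number, then $\mathcal{S}(\mathcal{H})$ has unbounded adaptive width.
   Context: A hypergraph is a pair $H=(V,E)$ with $V$ finite and $E\subseteq2^V\setminus\{\varnothing\}$. $\mathcal{S}(H)$ is the set of edge-super-hypergraphs of $H$, i.e. hypergraphs $(V,E')$ with $E\subseteq E'$; $\mathcal{S}(\mathcal{H})=\bigcup_{H\in\mathcal{H}}\mathcal{S}(H)$. For a partition $\tau$ of $V$ and $X\subseteq V$, $X/\tau:=\{B\in\tau:B\cap X\ne\varnothing\}$; the quotient is $H/\tau:=(\tau,\{e/\tau:e\in E\})$; $\mathcal{Q}(H)$ is the set of quotients of $H$ and $\mathcal{Q}(\mathcal{F})=\bigcup_{F\in\mathcal{F}}\mathcal{Q}(F)$. For invariants, each isolated vertex $v$ is placed into an extra edge $\{v\}$. $\rho^\ast_H(X)$ is the minimum of $\sum_e\xi(e)$ over $\xi:E\to\mathbb{R}_{\ge0}$ with $\sum_{e\ni v}\xi(e)\ge1$ for all $v\in X$; the fractional edge-cover number is $\rho^\ast(H)=\rho^\ast_H(V)$. A tree decomposition of $H$ is a tree $T$ with bags $B_t\subseteq V$ covering $V$, every edge inside some bag, and for each $v$ the nodes containing $v$ forming a connected subtree. For $f:2^V\to\mathbb{R}_{\ge0}$ the $f$-width of $H$ is the minimum over decompositions of $\max_t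 f(B_t)$. Fractional hypertree width is the $\rho^\ast_H$-width. A fractional independent set is $\mu:V\to\mathbb{R}_{\ge0}$ with $\sum_{v\in e}\mu(v)\le1$ for all $e$, extended additively to sets; adaptive width is the supremum of the $\mu$-width over all fractional independent sets $\mu$. Bounded on a class means finite supremum.
   Formalization: The weights of fractional edge covers ξ and of fractional independent sets μ take values in the nonnegative rationals instead of $\mathbb{R}_{\ge0}$. -}

module Defs where

open import Data.Nat using (ℕ; zero; suc; _≡ᵇ_)
open import Data.Bool using (Bool; true; false; _∧_; _∨_; not; if_then_else_)
open import Data.Fin using (Fin; zero; suc; _≟_)
open import Data.Fin.Subset using (Subset; _∈_; _∉_; _⊆_; ∣_∣; Nonempty)
open import Data.Vec using (Vec; []; _∷_; lookup; tabulate)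
open import Data.List using (List; []; _∷_; [_]; _++_; map; foldr)
open import Data.Bool.ListAction using (any)
open import Data.List.Relation.Unary.Any using (Any)
open import Data.List.Relation.Unary.All using (All)
open import Data.List.Relation.Unary.AllPairs using (AllPairs)
open import Data.Integer using (+_)
open import Data.Rational using (ℚ; 0ℚ; 1ℚ; _+_; _≤_; _<_; _/_)
open import Data.Product using (Σ; ∃; _×_)
open import Relation.Binary.PropositionalEquality using (_≡_)
open import Relation.Nullary using (¬_)
open import Relation.Nullary.Decidable using (isYes)

record Hypergraph (n : ℕ) : Set where
  field
    edge     : Subset n → Bool
    nonempty : ∀ e → edge e ≡ true → Nonempty e
open Hypergraph public

Class : Set₁
Class = (n : ℕ) → Hypergraph n → Set

allSubsets : (n : ℕ) → List (Subset n)
allSubsets zero    = [ [] ]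
allSubsets (suc n) = map (true ∷_) (allSubsets n) ++ map (false ∷_) (allSubsets n)

anyFin : ∀ {n} → (Fin n → Bool) → Bool
anyFin {zero}  f = false
anyFin {suc n} f = f zero ∨ anyFin (λ i → f (suc i))

allFin : ∀ {n} → (Fin n → Bool) → Bool
allFin {zero}  f = true
allFin {suc n} f = f zero ∧ allFin (λ i → f (suc i))

sumSubsets : ∀ {n} → (Subset n → Bool) → (Subset n → ℚ) → ℚ
sumSubsets {n} P f = foldr (λ e acc → (if P e then f e else 0ℚ) + acc) 0ℚ (allSubsets n)

sumFin : ∀ {n} → Subset n → (Fin n → ℚ) → ℚ
sumFin {zero}  X       f = 0ℚ
sumFin {suc n} (b ∷ X) f = (if b then f zero else 0ℚ) + sumFin X (λ i → f (suc i))

fromℕ : ℕ → ℚ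
fromℕ k = (+ k) / 1

-- Edges used for invariants: every isolated vertex v gets the extra edge {v}.

isolated : ∀ {n} → Hypergraph n → Fin n → Bool
isolated {n} H v = not (any (λ e → edge H e ∧ lookup e v) (allSubsets n))

invEdge : ∀ {n} → Hypergraph n → Subset n → Bool
invEdge H e = edge H e ∨ ((∣ e ∣ ≡ᵇ 1) ∧ allFin (λ v → not (lookup e v) ∨ isolated H v))

-- Fractional edge covers.  ρ*_H(X) ≤ c  iff there is a fractional edge
-- cover of X of total weight ≤ c (the LP minimum is attained, at a
-- rational point).

record FracCover {n} (H : Hypergraph n) (X : Subset n) (c : ℚ) : Set where
  field
    ξ       : Subset n → ℚ
    nonneg  : ∀ e → 0ℚ ≤ ξ e
    covers  : ∀ v → v ∈ X → 1ℚ ≤ sumSubsets (λ e → invEdge H e ∧ lookup e v) ξ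
    total≤  : sumSubsets (invEdge H) ξ ≤ c

ρ*≤ : ∀ {n} → Hypergraph n → Subset n → ℚ → Set
ρ*≤ H X c = FracCover H X c

full : ∀ {n} → Subset n
full = tabulate (λ _ → true)

ρ*V≤ : ∀ {n} → Hypergraph n → ℚ → Set
ρ*V≤ H c = ρ*≤ H full c

record FracIndep {n} (H : Hypergraph n) : Set where
  field
    μ      : Fin n → ℚ
    nonneg : ∀ v → 0ℚ ≤ μ v
    packed : ∀ e → invEdge H e ≡ true → sumFin e μ ≤ 1ℚ

data Tree (A : Set) : Set where
  node : A → List (Tree A) → Tree A

root : ∀ {A} → Tree A → A
root (node b _) = b

data AnyBag {A : Set} (P : A → Set) : Tree A → Set where
  here  : ∀ {b ts} → P b → AnyBag P (node b ts)
  there : ∀ {b ts} → Any (AnyBag P) ts → AnyBag P (node b ts)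

data AllBags {A : Set} (P : A → Set) : Tree A → Set where
  node : ∀ {b ts} → P b → All (AllBags P) ts → AllBags P (node b ts)

-- The nodes whose bag contains v form a connected subtree.  For a rooted
-- tree this is: at each node t, if v ∈ B_t then every child subtree
-- containing v has v in the child's bag; if v ∉ B_t then at most one
-- child subtree contains v; recursively in all children.
data Conn {n} (v : Fin n) : Tree (Subset n) → Set where
  inside  : ∀ {b ts} → v ∈ b
          → All (λ c → AnyBag (v ∈_) c → v ∈ root c) ts
          → All (Conn v) ts → Conn v (node b ts)
  outside : ∀ {b ts} → v ∉ b
          → AllPairs (λ c d → ¬ (AnyBag (v ∈_) c × AnyBag (v ∈_) d)) ts
          → All (Conn v) ts → Conn v (node b ts)

record TreeDecomp {n} (H : Hypergraph n) (T : Tree (Subset n)) : Set where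
  field
    coversV : ∀ v → AnyBag (v ∈_) T
    coversE : ∀ e → edge H e ≡ true → AnyBag (e ⊆_) T
    conn    : ∀ v → Conn v T

𝒮 : Class → Class
𝒮 𝓗 n H′ = Σ (Hypergraph n) λ H → 𝓗 n H × (∀ e → edge H e ≡ true → edge H′ e ≡ true)

image : ∀ {n k} → (Fin n → Fin k) → Subset n → Subset k
image π e = tabulate (λ j → anyFin (λ i → lookup e i ∧ isYes (π i ≟ j)))

-- F is (isomorphic to) the quotient H/τ, where τ is the partition of
-- Fin n into the k nonempty blocks π⁻¹(j), labelled by Fin k.
IsQuotient : ∀ {n k} → Hypergraph n → (Fin n → Fin k) → Hypergraph k → Set
IsQuotient {n} {k} H π F =
  (∀ (j : Fin k) → ∃ λ i → π i ≡ j) ×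
  (∀ e′ → edge F e′ ≡ true → ∃ λ e → edge H e ≡ true × image π e ≡ e′) ×
  (∀ e → edge H e ≡ true → edge F (image π e) ≡ true)

𝒬 : Class → Class
𝒬 𝓕 k F = Σ ℕ λ n → Σ (Hypergraph n) λ H → Σ (Fin n → Fin k) λ π → 𝓕 n H × IsQuotient H π F

BoundedFracEdgeCover : Class → Set
BoundedFracEdgeCover 𝓗 = Σ ℕ λ N → ∀ n H → 𝓗 n H → ρ*V≤ H (fromℕ N)

BoundedFHW : Class → Set
BoundedFHW 𝓕 = Σ ℕ λ N → ∀ n F → 𝓕 n F →
  Σ (Tree (Subset n)) λ T → TreeDecomp F T × AllBags (λ B → ρ*≤ F B (fromℕ N)) T

BoundedAdaptiveWidth : Class → Set
BoundedAdaptiveWidth 𝓗 = Σ ℕ λ N → ∀ n H → 𝓗 n H → (m : FracIndep H) →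
  Σ (Tree (Subset n)) λ T → TreeDecomp H T ×
    AllBags (λ B → sumFin B (FracIndep.μ m) ≤ fromℕ N) T

-- If ρ*(H) ≤ N, every fractional independent set of a quotient F of a super-hypergraph of H has
-- weight ≤ N: pulled back along a section of the quotient map it is packed on every edge of H
-- (the image of an edge of H is an edge of F), so weak LP duality applies. By strong duality
-- ρ*(F) ≤ N + 1, and the decomposition of F with a single bag has fractional width ≤ N + 1.
-- Conversely, suppose all super-hypergraphs of H have adaptive width ≤ N and add to H every edge
-- with one or two vertices. Half of a fractional independent set of H is one of the new
-- hypergraph, and in any of its tree decompositions every two vertices share a bag, so by the
-- Helly property of subtrees some bag contains all vertices. Hence fractional independent sets
-- of H weigh at most 2N, and by duality ρ*(H) ≤ 2N + 1. Strong LP duality is obtained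
-- constructively by Fourier–Motzkin elimination.

module Submission where

open import Defs
open import Data.Bool using (Bool; true; false; _∧_; _∨_; not; if_then_else_)
open import Data.Bool.Properties using (∨-zeroʳ; ∧-conicalˡ; ∧-conicalʳ; T-≡; T-∧)
open import Data.Bool.ListAction using (any)
open import Data.Nat as ℕ using (ℕ; zero; suc; z≤n; s≤s; _≤ᵇ_; _≡ᵇ_)
import Data.Nat.Properties as ℕ
import Data.Integer as ℤ
import Data.Integer.Properties as ℤ
import Data.Integer.Tactic.RingSolver as ℤ-Solver
open import Data.Rational
  using ( ℚ; 0ℚ; 1ℚ; ½; _+_; _*_; -_; _-_; _≤_; _<_; 1/_; toℚᵘ
        ; NonZero; Positive; >-nonZero; positive; nonNegative)
open import Data.Rational.Properties renaming (_≟_ to _≟ℚ_)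
open import Data.Rational.Unnormalised as ℚᵘ using (ℚᵘ; mkℚᵘ; *≡*)
import Data.Rational.Unnormalised.Properties as ℚᵘ
open import Data.Fin using (Fin; zero; suc; _≟_)
open import Data.Fin.Properties using (all?; ¬∀⟶∃¬)
open import Data.Fin.Subset using (Subset; ⁅_⁆; ⊥; ∣_∣; _∈_; _∉_; _⊆_; _∪_; Nonempty)
open import Data.Fin.Subset.Properties
  using ( _∈?_; drop-∷-⊆; x∈⁅x⁆; x∈⁅y⁆⇒x≡y; x∈p∪q⁺; ∣⁅x⁆∣≡1; ∣p∣≤∣x∷p∣; ∣p∣≤∣p∪q∣; ∣⊥∣≡0
        ; nonempty?; Empty-unique)
open import Data.Vec as Vec using (Vec; []; _∷_; lookup; tabulate; zipWith; replicate; here)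
open import Data.Vec.Properties
  using (lookup-map; lookup-zipWith; lookup-replicate; lookup∘tabulate; []=⇒lookup; lookup⇒[]=)
open import Data.List as List using (List; []; _∷_; _++_; foldr; concatMap)
open import Data.List.Relation.Unary.All as All using (All; []; _∷_)
import Data.List.Relation.Unary.All.Properties as All
open import Data.List.Relation.Unary.Any using (Any; here; there; satisfied)
open import Data.List.Relation.Unary.Any.Properties using (any⁻)
open import Data.List.Relation.Unary.AllPairs using (AllPairs; _∷_)
open import Data.List.Membership.Propositional using (find) renaming (_∈_ to _∈ₗ_)
open import Data.List.Membership.Propositional.Properties using (∈-++⁺ˡ; ∈-++⁺ʳ; ∈-map⁺; ∈-allFin)
open import Data.Product using (Σ; ∃; _×_; _,_; proj₁; proj₂; uncurry)
open import Data.Sum as Sum using (_⊎_; inj₁; inj₂; [_,_]′)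
open import Data.Maybe using (Maybe; just; nothing)
open import Data.Empty using (⊥-elim)
open import Function using (_∘_; id)
open import Function.Bundles using (Equivalence)
open import Level using (0ℓ)
open import Relation.Binary.Bundles using (DecTotalOrder)
open import Relation.Binary.Definitions using (tri<; tri≈; tri>)
open import Relation.Binary.PropositionalEquality
open import Relation.Nullary using (yes; no; ¬_; contradiction)
open import Relation.Nullary.Decidable using (isYes)
open import Tactic.RingSolver using (solve-∀)
import Tactic.RingSolver.Core.AlmostCommutativeRing as ACR
open import Data.List.Extrema (DecTotalOrder.totalOrder ≤-decTotalOrder)
  using (min; max; min≤xs; xs≤max; max≤v⁺)

ℚ-ring : ACR.AlmostCommutativeRing 0ℓ 0ℓ
ℚ-ring = ACR.fromCommutativeRing +-*-commutativeRing is-0ℚ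
  where
  is-0ℚ : (p : ℚ) → Maybe (0ℚ ≡ p)
  is-0ℚ p with 0ℚ ≟ℚ p
  ... | yes 0≡p = just 0≡p
  ... | no _    = nothing

*-nonNeg : ∀ {p q} → 0ℚ ≤ p → 0ℚ ≤ q → 0ℚ ≤ p * q
*-nonNeg {p} {q} 0≤p 0≤q =
  nonNegative⁻¹ _ {{nonNeg*nonNeg⇒nonNeg p {{nonNegative 0≤p}} q {{nonNegative 0≤q}}}}

*-monoˡ-≤-0≤ : ∀ l {p q} → 0ℚ ≤ l → p ≤ q → l * p ≤ l * q
*-monoˡ-≤-0≤ l 0≤l = *-monoˡ-≤-nonNeg l {{nonNegative 0≤l}}

0≤p-q⇒q≤p : ∀ {p q} → 0ℚ ≤ p - q → q ≤ p
0≤p-q⇒q≤p {p} {q} h = subst₂ _≤_ (+-identityˡ q) (lemma p q) (+-monoˡ-≤ q h)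
  where
  lemma : ∀ p q → p - q + q ≡ p
  lemma = solve-∀ ℚ-ring

p-q<0⇒p<q : ∀ {p q} → p - q < 0ℚ → p < q
p-q<0⇒p<q {p} {q} h = subst₂ _<_ (lemma p q) (+-identityˡ q) (+-monoˡ-< q h)
  where
  lemma : ∀ p q → p - q + q ≡ p
  lemma = solve-∀ ℚ-ring

-1*p≤-q⇒q≤p : ∀ {p q} → - 1ℚ * p ≤ - q → q ≤ p
-1*p≤-q⇒q≤p {p} {q} h = subst₂ _≤_ (lemma₁ q) (lemma₂ p) (neg-antimono-≤ h)
  where
  lemma₁ : ∀ q → - - q ≡ q
  lemma₁ = solve-∀ ℚ-ring
  lemma₂ : ∀ p → - (- 1ℚ * p) ≡ p
  lemma₂ = solve-∀ ℚ-ring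

x<1+x : ∀ x → x < 1ℚ + x
x<1+x x = subst (_< 1ℚ + x) (+-identityˡ x) (+-monoˡ-< x (positive⁻¹ 1ℚ))

-- fromℕ k is the normalised + k / 1, so additivity is checked on unnormalised rationals.
fromℕ-+ : ∀ m n → fromℕ (m ℕ.+ n) ≡ fromℕ m + fromℕ n
fromℕ-+ m n = toℚᵘ-injective (begin
  toℚᵘ (fromℕ (m ℕ.+ n))             ≈⟨ toℚᵘ-fromℚᵘ (ℕ→ℚᵘ (m ℕ.+ n)) ⟩
  ℕ→ℚᵘ (m ℕ.+ n)                     ≈⟨ *≡* (trans (cong (ℤ._* ℤ.+ 1) (ℤ.pos-+ m n))
                                                   (lemma (ℤ.+ m) (ℤ.+ n))) ⟩
  ℕ→ℚᵘ m ℚᵘ.+ ℕ→ℚᵘ n                 ≈⟨ ℚᵘ.+-cong (ℚᵘ.≃-sym (toℚᵘ-fromℚᵘ (ℕ→ℚᵘ m)))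
                                                (ℚᵘ.≃-sym (toℚᵘ-fromℚᵘ (ℕ→ℚᵘ n))) ⟩
  toℚᵘ (fromℕ m) ℚᵘ.+ toℚᵘ (fromℕ n) ≈⟨ ℚᵘ.≃-sym (toℚᵘ-homo-+ (fromℕ m) (fromℕ n)) ⟩
  toℚᵘ (fromℕ m + fromℕ n)           ∎)
  where
  open ℚᵘ.≃-Reasoning
  ℕ→ℚᵘ : ℕ → ℚᵘ
  ℕ→ℚᵘ k = mkℚᵘ (ℤ.+ k) 0
  lemma : ∀ a b → (a ℤ.+ b) ℤ.* ℤ.+ 1 ≡ (a ℤ.* ℤ.+ 1 ℤ.+ b ℤ.* ℤ.+ 1) ℤ.* ℤ.+ 1
  lemma = ℤ-Solver.solve-∀

between : (ls us : List ℚ) → All (λ u → All (_≤ u) ls) us →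
          Σ ℚ λ x → All (_≤ x) ls × All (x ≤_) us
between ls us ls≤us = max (min 0ℚ us) ls , xs≤max _ ls ,
  All.zipWith (λ (m≤u , ls≤u) → max≤v⁺ m≤u ls≤u) (min≤xs 0ℚ us , ls≤us)

-- Fourier–Motzkin elimination

infix 7 _·_

_·_ : ∀ {d} → Vec ℚ d → Vec ℚ d → ℚ
[]       · []       = 0ℚ
(a ∷ as) · (x ∷ xs) = a * x + as · xs

·-distribʳ-+ : ∀ {d} (a b x : Vec ℚ d) → zipWith _+_ a b · x ≡ a · x + b · x
·-distribʳ-+ []       []       []       = refl
·-distribʳ-+ (a ∷ as) (b ∷ bs) (x ∷ xs) =
  trans (cong ((a + b) * x +_) (·-distribʳ-+ as bs xs)) (lemma a b x (as · xs) (bs · xs))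
  where
  lemma : ∀ a b x p q → (a + b) * x + (p + q) ≡ (a * x + p) + (b * x + q)
  lemma = solve-∀ ℚ-ring

map-*-· : ∀ {d} l (a x : Vec ℚ d) → Vec.map (l *_) a · x ≡ l * (a · x)
map-*-· l []       []       = sym (*-zeroʳ l)
map-*-· l (a ∷ as) (x ∷ xs) =
  trans (cong (l * a * x +_) (map-*-· l as xs)) (lemma l a x (as · xs))
  where
  lemma : ∀ l a x p → l * a * x + l * p ≡ l * (a * x + p)
  lemma = solve-∀ ℚ-ring

-- D a b reads "a · x ≤ b is derivable".
record IsConic {d} (D : Vec ℚ d → ℚ → Set) : Set where
  field
    +-closed : ∀ {a b a′ b′} → D a b → D a′ b′ → D (zipWith _+_ a a′) (b + b′)
    *-closed : ∀ {a b} l → 0ℚ ≤ l → D a b → D (Vec.map (l *_) a) (l * b)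

record Constraint {d} (D : Vec ℚ d → ℚ → Set) : Set where
  constructor constraint
  field
    coeffs    : Vec ℚ d
    bound     : ℚ
    derivable : D coeffs bound
open Constraint

infix 4 _⊨_

_⊨_ : ∀ {d} {D : Vec ℚ d → ℚ → Set} → Vec ℚ d → Constraint D → Set
x ⊨ c = coeffs c · x ≤ bound c

Solvable : ∀ {d} {D : Vec ℚ d → ℚ → Set} → List (Constraint D) → Set
Solvable {d} cs = Σ (Vec ℚ d) λ x → All (x ⊨_) cs

Refutable : ∀ {d} → (Vec ℚ d → ℚ → Set) → Set
Refutable {d} D = Σ ℚ λ b → b < 0ℚ × D (replicate d 0ℚ) b

fourierMotzkin₀ : ∀ {D : Vec ℚ 0 → ℚ → Set} (cs : List (Constraint D)) → Solvable cs ⊎ Refutable D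
fourierMotzkin₀ [] = inj₁ ([] , [])
fourierMotzkin₀ (constraint [] b p ∷ cs) with 0ℚ ≤? b | fourierMotzkin₀ cs
... | no 0≰b | _                = inj₂ (b , ≰⇒> 0≰b , p)
... | yes _  | inj₂ refutation  = inj₂ refutation
... | yes 0≤b | inj₁ ([] , sat) = inj₁ ([] , 0≤b ∷ sat)

Slice : ∀ {d} → ℚ → (Vec ℚ (suc d) → ℚ → Set) → Vec ℚ d → ℚ → Set
Slice s D a b = D (s ∷ a) b

module Elimination {d} {D : Vec ℚ (suc d) → ℚ → Set} (conic : IsConic D) where
  open IsConic conic

  lift : ∀ {s} → Constraint (Slice s D) → Constraint D
  lift {s} (constraint a b p) = constraint (s ∷ a) b p

  slice₀-conic : IsConic (Slice 0ℚ D)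
  slice₀-conic = record
    { +-closed = +-closed
    ; *-closed = *-closed₀
    }
    where
    *-closed₀ : ∀ {a b} l → 0ℚ ≤ l → D (0ℚ ∷ a) b → D (0ℚ ∷ Vec.map (l *_) a) (l * b)
    *-closed₀ {a} {b} l 0≤l p =
      subst (λ s → D (s ∷ Vec.map (l *_) a) (l * b)) (*-zeroʳ l) (*-closed l 0≤l p)

  data Shape (c : Constraint D) : Set where
    flat  : (r : Constraint (Slice 0ℚ D))     → (∀ y → y ⊨ lift r → y ⊨ c) → Shape c
    upper : (r : Constraint (Slice 1ℚ D))     → (∀ y → y ⊨ lift r → y ⊨ c) → Shape c
    lower : (r : Constraint (Slice (- 1ℚ) D)) → (∀ y → y ⊨ lift r → y ⊨ c) → Shape c

  rescale : ∀ {a₀ a b} (p : D (a₀ ∷ a) b) l .{{_ : Positive l}} {s} → l * a₀ ≡ s →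
            Σ (Constraint (Slice s D)) λ r → ∀ y → y ⊨ lift r → y ⊨ constraint {D = D} (a₀ ∷ a) b p
  rescale {a₀} {a} {b} p l refl =
    constraint (Vec.map (l *_) a) (l * b) (*-closed l (<⇒≤ (positive⁻¹ l)) p) ,
    λ y h → *-cancelˡ-≤-pos l (subst (_≤ l * b) (map-*-· l (a₀ ∷ a) y) h)

  shape : (c : Constraint D) → Shape c
  shape (constraint (a₀ ∷ a) b p) with <-cmp a₀ 0ℚ
  ... | tri≈ _ refl _ = flat (constraint a b p) (λ _ h → h)
  ... | tri> _ _ a₀>0 = uncurry upper (rescale p (1/ a₀) (*-inverseˡ a₀))
    where
    instance
      a₀≢0 : NonZero a₀
      a₀≢0 = >-nonZero a₀>0
      1/a₀>0 : Positive (1/ a₀)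
      1/a₀>0 = 1/pos⇒pos a₀ {{positive a₀>0}}
  ... | tri< a₀<0 _ _ = uncurry lower (rescale p (1/ (- a₀)) l*a₀≡-1)
    where
    -a₀>0 : 0ℚ < - a₀
    -a₀>0 = neg-antimono-< a₀<0
    instance
      -a₀≢0 : NonZero (- a₀)
      -a₀≢0 = >-nonZero -a₀>0
      1/-a₀>0 : Positive (1/ (- a₀))
      1/-a₀>0 = 1/pos⇒pos (- a₀) {{positive -a₀>0}}
    l*a₀≡-1 : 1/ (- a₀) * a₀ ≡ - 1ℚ
    l*a₀≡-1 = trans (lemma (1/ (- a₀)) a₀) (cong -_ (*-inverseˡ (- a₀)))
      where
      lemma : ∀ l a → l * a ≡ - (l * - a)
      lemma = solve-∀ ℚ-ring

  record Split (cs : List (Constraint D)) : Set where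
    field
      flats  : List (Constraint (Slice 0ℚ D))
      uppers : List (Constraint (Slice 1ℚ D))
      lowers : List (Constraint (Slice (- 1ℚ) D))
      sound  : ∀ y → All (λ r → y ⊨ lift r) flats → All (λ r → y ⊨ lift r) uppers →
               All (λ r → y ⊨ lift r) lowers → All (y ⊨_) cs

  split : (cs : List (Constraint D)) → Split cs
  split [] = record { flats = [] ; uppers = [] ; lowers = [] ; sound = λ _ _ _ _ → [] }
  split (c ∷ cs) with shape c | split cs
  ... | flat r back | record { flats = fs ; uppers = us ; lowers = ls ; sound = sound } =
    record { flats = r ∷ fs ; uppers = us ; lowers = ls
           ; sound = λ { y (f ∷ sf) su sl → back y f ∷ sound y sf su sl } }
  ... | upper r back | record { flats = fs ; uppers = us ; lowers = ls ; sound = sound } =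
    record { flats = fs ; uppers = r ∷ us ; lowers = ls
           ; sound = λ { y sf (u ∷ su) sl → back y u ∷ sound y sf su sl } }
  ... | lower r back | record { flats = fs ; uppers = us ; lowers = ls ; sound = sound } =
    record { flats = fs ; uppers = us ; lowers = r ∷ ls
           ; sound = λ { y sf su (l ∷ sl) → back y l ∷ sound y sf su sl } }

  upperBound : Vec ℚ d → Constraint (Slice 1ℚ D) → ℚ
  upperBound x r = bound r - coeffs r · x

  lowerBound : Vec ℚ d → Constraint (Slice (- 1ℚ) D) → ℚ
  lowerBound x r = coeffs r · x - bound r

  -- No transport is needed: 1ℚ + - 1ℚ normalises to 0ℚ.
  combine : Constraint (Slice 1ℚ D) → Constraint (Slice (- 1ℚ) D) → Constraint (Slice 0ℚ D)
  combine (constraint a b p) (constraint a′ b′ p′) =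
    constraint (zipWith _+_ a a′) (b + b′) (+-closed p p′)

  combine-sound : ∀ x u l → x ⊨ combine u l → lowerBound x l ≤ upperBound x u
  combine-sound x (constraint a b _) (constraint a′ b′ _) h =
    subst₂ _≤_ (lemma₁ (a · x) (a′ · x) b b′) (lemma₂ (a · x) b b′)
      (+-monoˡ-≤ (- (a · x) - b′) (subst (_≤ b + b′) (·-distribʳ-+ a a′ x) h))
    where
    lemma₁ : ∀ p q b b′ → p + q + (- p - b′) ≡ q - b′
    lemma₁ = solve-∀ ℚ-ring
    lemma₂ : ∀ p b b′ → b + b′ + (- p - b′) ≡ b - p
    lemma₂ = solve-∀ ℚ-ring

  flat-⊨ : ∀ x₀ x r → x ⊨ r → (x₀ ∷ x) ⊨ lift {0ℚ} r
  flat-⊨ x₀ x r h = subst (_≤ bound r) (lemma x₀ (coeffs r · x)) h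
    where
    lemma : ∀ x₀ p → p ≡ 0ℚ * x₀ + p
    lemma = solve-∀ ℚ-ring

  upper-⊨ : ∀ x₀ x r → x₀ ≤ upperBound x r → (x₀ ∷ x) ⊨ lift {1ℚ} r
  upper-⊨ x₀ x r h = subst₂ _≤_ (lemma₁ x₀ (coeffs r · x)) (lemma₂ (coeffs r · x) (bound r))
    (+-monoˡ-≤ (coeffs r · x) h)
    where
    lemma₁ : ∀ x₀ p → x₀ + p ≡ 1ℚ * x₀ + p
    lemma₁ = solve-∀ ℚ-ring
    lemma₂ : ∀ p b → b - p + p ≡ b
    lemma₂ = solve-∀ ℚ-ring

  lower-⊨ : ∀ x₀ x r → lowerBound x r ≤ x₀ → (x₀ ∷ x) ⊨ lift { - 1ℚ} r
  lower-⊨ x₀ x r h = subst₂ _≤_ (lemma₁ x₀ (coeffs r · x) (bound r)) (lemma₂ x₀ (bound r))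
    (+-monoˡ-≤ (bound r - x₀) h)
    where
    lemma₁ : ∀ x₀ p b → p - b + (b - x₀) ≡ - 1ℚ * x₀ + p
    lemma₁ = solve-∀ ℚ-ring
    lemma₂ : ∀ x₀ b → x₀ + (b - x₀) ≡ b
    lemma₂ = solve-∀ ℚ-ring

  eliminate : List (Constraint D) → List (Constraint (Slice 0ℚ D))
  eliminate cs = flats ++ concatMap (λ u → List.map (combine u) lowers) uppers
    where open Split (split cs)

  extend : ∀ cs → Solvable (eliminate cs) → Solvable cs
  extend cs (x , sat) = x₀ ∷ x , sound (x₀ ∷ x) flats⊨ uppers⊨ lowers⊨
    where
    open Split (split cs)
    combined⊨ : All (λ u → All (λ l → x ⊨ combine u l) lowers) uppers
    combined⊨ = All.map All.map⁻ (All.map⁻ (All.concat⁻ (All.++⁻ʳ flats sat)))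
    ls us : List ℚ
    ls = List.map (lowerBound x) lowers
    us = List.map (upperBound x) uppers
    ls≤us : All (λ u → All (_≤ u) ls) us
    ls≤us = All.map⁺ (All.map (λ {u} ⊨u → All.map⁺ (All.map (λ {l} → combine-sound x u l) ⊨u)) combined⊨)
    bounds : Σ ℚ λ x₀ → All (_≤ x₀) ls × All (x₀ ≤_) us
    bounds = between ls us ls≤us
    x₀ : ℚ
    x₀ = proj₁ bounds
    flats⊨ : All (λ r → (x₀ ∷ x) ⊨ lift r) flats
    flats⊨ = All.map (λ {r} → flat-⊨ x₀ x r) (All.++⁻ˡ flats sat)
    uppers⊨ : All (λ r → (x₀ ∷ x) ⊨ lift r) uppers
    uppers⊨ = All.map (λ {r} → upper-⊨ x₀ x r) (All.map⁻ (proj₂ (proj₂ bounds)))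
    lowers⊨ : All (λ r → (x₀ ∷ x) ⊨ lift r) lowers
    lowers⊨ = All.map (λ {r} → lower-⊨ x₀ x r) (All.map⁻ (proj₁ (proj₂ bounds)))

fourierMotzkin : ∀ {d} {D : Vec ℚ d → ℚ → Set} → IsConic D →
                 (cs : List (Constraint D)) → Solvable cs ⊎ Refutable D
fourierMotzkin {zero}  _     cs = fourierMotzkin₀ cs
fourierMotzkin {suc d} conic cs =
  Sum.map₁ (extend cs) (fourierMotzkin slice₀-conic (eliminate cs))
  where open Elimination conic

onlyIf : Bool → ℚ → ℚ
onlyIf b q = if b then q else 0ℚ

sumOver : ∀ {A : Set} → List A → (A → ℚ) → ℚ
sumOver xs f = foldr (λ x acc → f x + acc) 0ℚ xs

sumOver-cong : ∀ {A : Set} (xs : List A) (f g : A → ℚ) → (∀ x → f x ≡ g x) →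
               sumOver xs f ≡ sumOver xs g
sumOver-cong []       f g f≡g = refl
sumOver-cong (x ∷ xs) f g f≡g = cong₂ _+_ (f≡g x) (sumOver-cong xs f g f≡g)

sumOver-mono : ∀ {A : Set} (xs : List A) (f g : A → ℚ) → (∀ x → f x ≤ g x) →
               sumOver xs f ≤ sumOver xs g
sumOver-mono []       f g f≤g = ≤-refl
sumOver-mono (x ∷ xs) f g f≤g = +-mono-≤ (f≤g x) (sumOver-mono xs f g f≤g)

sumOver-+ : ∀ {A : Set} (xs : List A) (f g : A → ℚ) →
            sumOver xs (λ x → f x + g x) ≡ sumOver xs f + sumOver xs g
sumOver-+ []       f g = sym (+-identityˡ 0ℚ)
sumOver-+ (x ∷ xs) f g =
  trans (cong ((f x + g x) +_) (sumOver-+ xs f g)) (lemma (f x) (g x) (sumOver xs f) (sumOver xs g))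
  where
  lemma : ∀ a b c d → a + b + (c + d) ≡ a + c + (b + d)
  lemma = solve-∀ ℚ-ring

sumOver-* : ∀ {A : Set} (xs : List A) (k : ℚ) (f : A → ℚ) →
            sumOver xs (λ x → k * f x) ≡ k * sumOver xs f
sumOver-* []       k f = sym (*-zeroʳ k)
sumOver-* (x ∷ xs) k f =
  trans (cong (k * f x +_) (sumOver-* xs k f)) (sym (*-distribˡ-+ k (f x) (sumOver xs f)))

sumOver-0 : ∀ {A : Set} (xs : List A) → sumOver xs (λ _ → 0ℚ) ≡ 0ℚ
sumOver-0 []       = refl
sumOver-0 (x ∷ xs) = trans (+-identityˡ _) (sumOver-0 xs)

sumOver-++ : ∀ {A : Set} (xs ys : List A) (f : A → ℚ) →
             sumOver (xs ++ ys) f ≡ sumOver xs f + sumOver ys f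
sumOver-++ []       ys f = sym (+-identityˡ _)
sumOver-++ (x ∷ xs) ys f =
  trans (cong (f x +_) (sumOver-++ xs ys f)) (sym (+-assoc (f x) (sumOver xs f) (sumOver ys f)))

sumOver-map : ∀ {A B : Set} (g : A → B) (xs : List A) (f : B → ℚ) →
              sumOver (List.map g xs) f ≡ sumOver xs (λ x → f (g x))
sumOver-map g []       f = refl
sumOver-map g (x ∷ xs) f = cong (f (g x) +_) (sumOver-map g xs f)

onlyIf-nonneg : ∀ b {x} → 0ℚ ≤ x → 0ℚ ≤ onlyIf b x
onlyIf-nonneg true  0≤x = 0≤x
onlyIf-nonneg false _   = ≤-refl

onlyIf-mono : ∀ b {x y} → (b ≡ true → x ≤ y) → onlyIf b x ≤ onlyIf b y
onlyIf-mono true  x≤y = x≤y refl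
onlyIf-mono false _   = ≤-refl

onlyIf-+ : ∀ b x y → onlyIf b (x + y) ≡ onlyIf b x + onlyIf b y
onlyIf-+ true  x y = refl
onlyIf-+ false x y = sym (+-identityˡ 0ℚ)

onlyIf-* : ∀ b k x → onlyIf b (k * x) ≡ k * onlyIf b x
onlyIf-* true  k x = refl
onlyIf-* false k x = sym (*-zeroʳ k)

onlyIf-*ʳ : ∀ b x k → onlyIf b (x * k) ≡ onlyIf b x * k
onlyIf-*ʳ true  x k = refl
onlyIf-*ʳ false x k = sym (*-zeroˡ k)

onlyIf-0 : ∀ b → onlyIf b 0ℚ ≡ 0ℚ
onlyIf-0 true  = refl
onlyIf-0 false = refl

onlyIf-∧ : ∀ a b x → onlyIf (a ∧ b) x ≡ onlyIf a (onlyIf b x)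
onlyIf-∧ true  b x = refl
onlyIf-∧ false b x = refl

module _ {n : ℕ} (P : Subset n → Bool) where

  private
    terms : (Subset n → ℚ) → Subset n → ℚ
    terms f e = onlyIf (P e) (f e)

  sumSubsets-cong : ∀ {f g} → (∀ e → f e ≡ g e) → sumSubsets P f ≡ sumSubsets P g
  sumSubsets-cong {f} {g} f≡g =
    sumOver-cong (allSubsets n) (terms f) (terms g) (λ e → cong (onlyIf (P e)) (f≡g e))

  sumSubsets-+ : ∀ f g → sumSubsets P (λ e → f e + g e) ≡ sumSubsets P f + sumSubsets P g
  sumSubsets-+ f g =
    trans (sumOver-cong (allSubsets n) _ _ (λ e → onlyIf-+ (P e) (f e) (g e)))
          (sumOver-+ (allSubsets n) (terms f) (terms g))

  sumSubsets-* : ∀ k f → sumSubsets P (λ e → k * f e) ≡ k * sumSubsets P f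
  sumSubsets-* k f =
    trans (sumOver-cong (allSubsets n) _ _ (λ e → onlyIf-* (P e) k (f e)))
          (sumOver-* (allSubsets n) k (terms f))

  sumSubsets-0 : sumSubsets P (λ _ → 0ℚ) ≡ 0ℚ
  sumSubsets-0 =
    trans (sumOver-cong (allSubsets n) _ _ (λ e → onlyIf-0 (P e))) (sumOver-0 (allSubsets n))

  sumSubsets-mono : ∀ f g → (∀ e → P e ≡ true → f e ≤ g e) → sumSubsets P f ≤ sumSubsets P g
  sumSubsets-mono f g f≤g =
    sumOver-mono (allSubsets n) (terms f) (terms g) (λ e → onlyIf-mono (P e) (f≤g e))

  sumSubsets-nonneg : ∀ f → (∀ e → 0ℚ ≤ f e) → 0ℚ ≤ sumSubsets P f
  sumSubsets-nonneg f f≥0 =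
    subst (_≤ sumSubsets P f) sumSubsets-0 (sumSubsets-mono (λ _ → 0ℚ) f (λ e _ → f≥0 e))

  sumSubsets-∧ : ∀ (Q : Subset n → Bool) f →
                 sumSubsets (λ e → P e ∧ Q e) f ≡ sumSubsets P (λ e → onlyIf (Q e) (f e))
  sumSubsets-∧ Q f =
    sumOver-cong (allSubsets n) (λ e → onlyIf (P e ∧ Q e) (f e)) (terms (λ e → onlyIf (Q e) (f e)))
                 (λ e → onlyIf-∧ (P e) (Q e) (f e))

infix 4 _==_

_==_ : ∀ {n} → Subset n → Subset n → Bool
[]          == []          = true
(true  ∷ p) == (true  ∷ q) = p == q
(false ∷ p) == (false ∷ q) = p == q
(_     ∷ _) == (_     ∷ _) = false

pointMass : ∀ {n} → Subset n → Subset n → ℚ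
pointMass e₀ e = onlyIf (e == e₀) 1ℚ

pointMass-nonneg : ∀ {n} (e₀ e : Subset n) → 0ℚ ≤ pointMass e₀ e
pointMass-nonneg e₀ e = onlyIf-nonneg (e == e₀) (≤ᵇ⇒≤ _)

sumSubsets-pointMass : ∀ {n} (P : Subset n → Bool) e₀ → sumSubsets P (pointMass e₀) ≡ onlyIf (P e₀) 1ℚ
sumSubsets-pointMass {zero} P [] = +-identityʳ _
sumSubsets-pointMass {suc n} P (b ∷ e₀) = begin
  sumOver (List.map (true ∷_) es ++ List.map (false ∷_) es) F
    ≡⟨ sumOver-++ (List.map (true ∷_) es) _ F ⟩
  sumOver (List.map (true ∷_) es) F + sumOver (List.map (false ∷_) es) F
    ≡⟨ cong₂ _+_ (sumOver-map (true ∷_) es F) (sumOver-map (false ∷_) es F) ⟩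
  sumSubsets (λ e → P (true ∷ e)) (λ e → pointMass (b ∷ e₀) (true ∷ e)) +
  sumSubsets (λ e → P (false ∷ e)) (λ e → pointMass (b ∷ e₀) (false ∷ e))
    ≡⟨ byHead b ⟩
  onlyIf (P (b ∷ e₀)) 1ℚ ∎
  where
  open ≡-Reasoning
  es : List (Subset n)
  es = allSubsets n
  F : Subset (suc n) → ℚ
  F e = onlyIf (P e) (pointMass (b ∷ e₀) e)
  byHead : ∀ b → sumSubsets (λ e → P (true ∷ e)) (λ e → pointMass (b ∷ e₀) (true ∷ e)) +
                 sumSubsets (λ e → P (false ∷ e)) (λ e → pointMass (b ∷ e₀) (false ∷ e)) ≡
                 onlyIf (P (b ∷ e₀)) 1ℚ
  byHead true  = trans (cong₂ _+_ (sumSubsets-pointMass (λ e → P (true ∷ e)) e₀)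
                                  (sumSubsets-0 (λ e → P (false ∷ e))))
                       (+-identityʳ _)
  byHead false = trans (cong₂ _+_ (sumSubsets-0 (λ e → P (true ∷ e)))
                                  (sumSubsets-pointMass (λ e → P (false ∷ e)) e₀))
                       (+-identityˡ _)

∈-allSubsets : ∀ {n} (e : Subset n) → e ∈ₗ allSubsets n
∈-allSubsets []                = here refl
∈-allSubsets {suc n} (true ∷ e)  = ∈-++⁺ˡ (∈-map⁺ (true ∷_) (∈-allSubsets e))
∈-allSubsets {suc n} (false ∷ e) =
  ∈-++⁺ʳ (List.map (true ∷_) (allSubsets n)) (∈-map⁺ (false ∷_) (∈-allSubsets e))

sumFin-cong : ∀ {n} (X : Subset n) {f g : Fin n → ℚ} → (∀ v → f v ≡ g v) → sumFin X f ≡ sumFin X g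
sumFin-cong []      f≡g = refl
sumFin-cong (b ∷ X) f≡g = cong₂ _+_ (cong (onlyIf b) (f≡g zero)) (sumFin-cong X (λ v → f≡g (suc v)))

sumFin-mono : ∀ {n} (X : Subset n) {f g : Fin n → ℚ} → (∀ v → f v ≤ g v) → sumFin X f ≤ sumFin X g
sumFin-mono []      f≤g = ≤-refl
sumFin-mono (b ∷ X) f≤g = +-mono-≤ (onlyIf-mono b (λ _ → f≤g zero)) (sumFin-mono X (λ v → f≤g (suc v)))

sumFin-mono-⊆ : ∀ {n} {X Y : Subset n} {f : Fin n → ℚ} → (∀ v → 0ℚ ≤ f v) → X ⊆ Y →
                sumFin X f ≤ sumFin Y f
sumFin-mono-⊆ {X = []}    {[]}    _   _   = ≤-refl
sumFin-mono-⊆ {X = x ∷ X} {y ∷ Y} {f} f≥0 X⊆Y =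
  +-mono-≤ (head x y X⊆Y) (sumFin-mono-⊆ (λ v → f≥0 (suc v)) (drop-∷-⊆ X⊆Y))
  where
  head : ∀ x y → (x ∷ X) ⊆ (y ∷ Y) → onlyIf x (f zero) ≤ onlyIf y (f zero)
  head false y _ = onlyIf-nonneg y (f≥0 zero)
  head true  y x∷X⊆y∷Y with x∷X⊆y∷Y here
  ... | here = ≤-refl

sumFin-*ʳ : ∀ {n} (X : Subset n) (f : Fin n → ℚ) k → sumFin X (λ v → f v * k) ≡ sumFin X f * k
sumFin-*ʳ []      f k = sym (*-zeroˡ k)
sumFin-*ʳ (b ∷ X) f k = begin
  onlyIf b (f zero * k) + sumFin X (λ v → f (suc v) * k)
    ≡⟨ cong₂ _+_ (onlyIf-*ʳ b (f zero) k) (sumFin-*ʳ X (λ v → f (suc v)) k) ⟩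
  onlyIf b (f zero) * k + sumFin X (λ v → f (suc v)) * k
    ≡⟨ sym (*-distribʳ-+ k (onlyIf b (f zero)) (sumFin X (λ v → f (suc v)))) ⟩
  (onlyIf b (f zero) + sumFin X (λ v → f (suc v))) * k ∎
  where open ≡-Reasoning

sumFin-⊥ : ∀ {n} (f : Fin n → ℚ) → sumFin ⊥ f ≡ 0ℚ
sumFin-⊥ {zero}  f = refl
sumFin-⊥ {suc n} f = trans (+-identityˡ _) (sumFin-⊥ (λ v → f (suc v)))

sumFin-⁅⁆ : ∀ {n} (v : Fin n) (f : Fin n → ℚ) → sumFin ⁅ v ⁆ f ≡ f v
sumFin-⁅⁆ zero    f = trans (cong (f zero +_) (sumFin-⊥ (λ v → f (suc v)))) (+-identityʳ _)
sumFin-⁅⁆ (suc v) f = trans (+-identityˡ _) (sumFin-⁅⁆ v (λ u → f (suc u)))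

sumFin-sumSubsets : ∀ {n m} (X : Subset n) (P : Subset m → Bool) (g : Fin n → Subset m → ℚ) →
                    sumFin X (λ v → sumSubsets P (g v)) ≡ sumSubsets P (λ e → sumFin X (λ v → g v e))
sumFin-sumSubsets []      P g = sym (sumSubsets-0 P)
sumFin-sumSubsets (b ∷ X) P g = begin
  onlyIf b (sumSubsets P (g zero)) + sumFin X (λ v → sumSubsets P (g (suc v)))
    ≡⟨ cong₂ _+_ (onlyIf-sumSubsets b) (sumFin-sumSubsets X P (λ v → g (suc v))) ⟩
  sumSubsets P (λ e → onlyIf b (g zero e)) + sumSubsets P (λ e → sumFin X (λ v → g (suc v) e))
    ≡⟨ sym (sumSubsets-+ P (λ e → onlyIf b (g zero e)) (λ e → sumFin X (λ v → g (suc v) e))) ⟩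
  sumSubsets P (λ e → sumFin (b ∷ X) (λ v → g v e)) ∎
  where
  open ≡-Reasoning
  onlyIf-sumSubsets : ∀ b → onlyIf b (sumSubsets P (g zero)) ≡ sumSubsets P (λ e → onlyIf b (g zero e))
  onlyIf-sumSubsets true  = refl
  onlyIf-sumSubsets false = sym (sumSubsets-0 P)

sumFin-tabulate : ∀ {k} (p : Fin k → Bool) (μ : Fin k → ℚ) x →
                  sumFin full (λ j → μ j * onlyIf (p j) x) ≡ sumFin (tabulate p) μ * x
sumFin-tabulate {zero}  p μ x = sym (*-zeroˡ x)
sumFin-tabulate {suc k} p μ x = begin
  μ zero * onlyIf (p zero) x + sumFin full (λ j → μ (suc j) * onlyIf (p (suc j)) x)
    ≡⟨ cong₂ _+_ (head (p zero)) (sumFin-tabulate (λ j → p (suc j)) (λ j → μ (suc j)) x) ⟩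
  onlyIf (p zero) (μ zero) * x + sumFin (tabulate (λ j → p (suc j))) (λ j → μ (suc j)) * x
    ≡⟨ sym (*-distribʳ-+ x (onlyIf (p zero) (μ zero))
                           (sumFin (tabulate (λ j → p (suc j))) (λ j → μ (suc j)))) ⟩
  sumFin (tabulate p) μ * x ∎
  where
  open ≡-Reasoning
  head : ∀ b → μ zero * onlyIf b x ≡ onlyIf b (μ zero) * x
  head true  = refl
  head false = trans (*-zeroʳ (μ zero)) (sym (*-zeroˡ x))

sumFin-≤-∣∣* : ∀ {n} (X : Subset n) {f : Fin n → ℚ} {k} → (∀ v → f v ≤ k) → sumFin X f ≤ fromℕ ∣ X ∣ * k
sumFin-≤-∣∣* []          {k = k} f≤k = ≤-reflexive (sym (*-zeroˡ k))
sumFin-≤-∣∣* (false ∷ X) f≤k = subst (_≤ _) (sym (+-identityˡ _)) (sumFin-≤-∣∣* X (λ v → f≤k (suc v)))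
sumFin-≤-∣∣* (true ∷ X) {k = k} f≤k =
  subst (_ ≤_) (sym eq) (+-mono-≤ (f≤k zero) (sumFin-≤-∣∣* X (λ v → f≤k (suc v))))
  where
  eq : fromℕ (suc ∣ X ∣) * k ≡ k + fromℕ ∣ X ∣ * k
  eq = trans (cong (_* k) (fromℕ-+ 1 ∣ X ∣))
             (trans (*-distribʳ-+ k 1ℚ (fromℕ ∣ X ∣)) (cong (_+ fromℕ ∣ X ∣ * k) (*-identityˡ k)))

-- LP duality for fractional edge covers

weight : ∀ {n} {H : Hypergraph n} → FracIndep H → ℚ
weight m = sumFin full (FracIndep.μ m)

χ : ∀ {n} → ℚ → Subset n → Vec ℚ n
χ k S = Vec.map (λ b → onlyIf b k) S

·-χ : ∀ {n} k (S : Subset n) (x : Vec ℚ n) → χ k S · x ≡ k * sumFin S (lookup x)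
·-χ k []      []       = sym (*-zeroʳ k)
·-χ k (b ∷ S) (x ∷ xs) =
  trans (cong₂ _+_ (head b) (·-χ k S xs)) (sym (*-distribˡ-+ k (onlyIf b x) (sumFin S (lookup xs))))
  where
  head : ∀ b → onlyIf b k * x ≡ k * onlyIf b x
  head true  = refl
  head false = trans (*-zeroˡ x) (sym (*-zeroʳ k))

module CoverLP {n} (H : Hypergraph n) (c : ℚ) where

  covering : Fin n → Subset n → Bool
  covering v e = invEdge H e ∧ lookup e v

  cover : (Subset n → ℚ) → Fin n → ℚ
  cover ξ v = sumSubsets (covering v) ξ

  total : (Subset n → ℚ) → ℚ
  total ξ = sumSubsets (invEdge H) ξ

  -- a · μ ≤ b follows from μ ≥ 0 by adding the packing inequalities μ(e) ≤ 1 with weights ξ e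
  -- and the inequality μ(V) ≥ c with weight s.
  record Derivable (a : Vec ℚ n) (b : ℚ) : Set where
    constructor derivation
    field
      ξ         : Subset n → ℚ
      s         : ℚ
      ξ≥0       : ∀ e → 0ℚ ≤ ξ e
      s≥0       : 0ℚ ≤ s
      dominated : ∀ v → lookup a v ≤ cover ξ v - s
      bounded   : total ξ - s * c ≤ b

  conic : IsConic Derivable
  conic = record { +-closed = +-closed ; *-closed = *-closed }
    where
    +-closed : ∀ {a b a′ b′} → Derivable a b → Derivable a′ b′ → Derivable (zipWith _+_ a a′) (b + b′)
    +-closed {a} {b} {a′} {b′} (derivation ξ s ξ≥0 s≥0 dom bnd) (derivation ξ′ s′ ξ′≥0 s′≥0 dom′ bnd′) =
      derivation (λ e → ξ e + ξ′ e) (s + s′) (λ e → +-mono-≤ (ξ≥0 e) (ξ′≥0 e)) (+-mono-≤ s≥0 s′≥0)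
        (λ v → subst₂ _≤_ (sym (lookup-zipWith _+_ v a a′)) (coverEq v) (+-mono-≤ (dom v) (dom′ v)))
        (subst (_≤ b + b′) totalEq (+-mono-≤ bnd bnd′))
      where
      lemma : ∀ p s p′ s′ → (p - s) + (p′ - s′) ≡ (p + p′) - (s + s′)
      lemma = solve-∀ ℚ-ring
      coverEq : ∀ v → (cover ξ v - s) + (cover ξ′ v - s′) ≡ cover (λ e → ξ e + ξ′ e) v - (s + s′)
      coverEq v = trans (lemma (cover ξ v) s (cover ξ′ v) s′)
                        (cong (_- (s + s′)) (sym (sumSubsets-+ (covering v) ξ ξ′)))
      lemma′ : ∀ t s t′ s′ c → (t - s * c) + (t′ - s′ * c) ≡ (t + t′) - (s + s′) * c
      lemma′ = solve-∀ ℚ-ring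
      totalEq : (total ξ - s * c) + (total ξ′ - s′ * c) ≡ total (λ e → ξ e + ξ′ e) - (s + s′) * c
      totalEq = trans (lemma′ (total ξ) s (total ξ′) s′ c)
                      (cong (_- (s + s′) * c) (sym (sumSubsets-+ (invEdge H) ξ ξ′)))
    *-closed : ∀ {a b} l → 0ℚ ≤ l → Derivable a b → Derivable (Vec.map (l *_) a) (l * b)
    *-closed {a} {b} l 0≤l (derivation ξ s ξ≥0 s≥0 dom bnd) =
      derivation (λ e → l * ξ e) (l * s) (λ e → *-nonNeg 0≤l (ξ≥0 e)) (*-nonNeg 0≤l s≥0)
        (λ v → subst₂ _≤_ (sym (lookup-map v (l *_) a)) (coverEq v) (*-monoˡ-≤-0≤ l 0≤l (dom v)))
        (subst (_≤ l * b) totalEq (*-monoˡ-≤-0≤ l 0≤l bnd))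
      where
      lemma : ∀ l p s → l * (p - s) ≡ l * p - l * s
      lemma = solve-∀ ℚ-ring
      coverEq : ∀ v → l * (cover ξ v - s) ≡ cover (λ e → l * ξ e) v - l * s
      coverEq v = trans (lemma l (cover ξ v) s) (cong (_- l * s) (sym (sumSubsets-* (covering v) l ξ)))
      lemma′ : ∀ l t s c → l * (t - s * c) ≡ l * t - l * s * c
      lemma′ = solve-∀ ℚ-ring
      totalEq : l * (total ξ - s * c) ≡ total (λ e → l * ξ e) - l * s * c
      totalEq = trans (lemma′ l (total ξ) s c) (cong (_- l * s * c) (sym (sumSubsets-* (invEdge H) l ξ)))

  private
    cover-0 : ∀ v → cover (λ _ → 0ℚ) v ≡ 0ℚ
    cover-0 v = sumSubsets-0 (covering v)

    total-0 : total (λ _ → 0ℚ) ≡ 0ℚ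
    total-0 = sumSubsets-0 (invEdge H)

    onlyIf-neg : ∀ b → onlyIf b (- 1ℚ) ≤ 0ℚ
    onlyIf-neg true  = ≤ᵇ⇒≤ _
    onlyIf-neg false = ≤-refl

    p≡p-0 : ∀ p → p ≡ p - 0ℚ
    p≡p-0 = solve-∀ ℚ-ring
    p≡p-0*c : ∀ p c → p ≡ p - 0ℚ * c
    p≡p-0*c = solve-∀ ℚ-ring
    -c≡0-1*c : ∀ c → - c ≡ 0ℚ - 1ℚ * c
    -c≡0-1*c = solve-∀ ℚ-ring

  vertexConstraint : Fin n → Constraint Derivable
  vertexConstraint v = constraint (χ (- 1ℚ) ⁅ v ⁆) 0ℚ
    (derivation (λ _ → 0ℚ) 0ℚ (λ _ → ≤-refl) ≤-refl dominated bounded)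
    where
    dominated : ∀ u → lookup (χ (- 1ℚ) ⁅ v ⁆) u ≤ cover (λ _ → 0ℚ) u - 0ℚ
    dominated u = subst₂ _≤_ (sym (lookup-map u _ ⁅ v ⁆)) (trans (sym (cover-0 u)) (p≡p-0 _))
                    (onlyIf-neg (lookup ⁅ v ⁆ u))
    bounded : total (λ _ → 0ℚ) - 0ℚ * c ≤ 0ℚ
    bounded = ≤-reflexive (sym (trans (p≡p-0*c 0ℚ c) (cong (λ t → t - 0ℚ * c) (sym total-0))))

  -- Every subset gets a constraint, scaled by [e is an invariant edge]; the others read 0 ≤ 0.
  edgeConstraint : Subset n → Constraint Derivable
  edgeConstraint e = constraint (χ w e) w
    (derivation (pointMass e) 0ℚ (pointMass-nonneg e) ≤-refl dominated bounded)
    where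
    w : ℚ
    w = onlyIf (invEdge H e) 1ℚ
    indicator : ∀ a b → onlyIf b (onlyIf a 1ℚ) ≡ onlyIf (a ∧ b) 1ℚ
    indicator true  b     = refl
    indicator false true  = refl
    indicator false false = refl
    dominated : ∀ u → lookup (χ w e) u ≤ cover (pointMass e) u - 0ℚ
    dominated u = ≤-reflexive (begin
      lookup (χ w e) u                                 ≡⟨ lookup-map u _ e ⟩
      onlyIf (lookup e u) w                            ≡⟨ indicator (invEdge H e) (lookup e u) ⟩
      onlyIf (covering u e) 1ℚ                         ≡⟨ sym (sumSubsets-pointMass (covering u) e) ⟩
      cover (pointMass e) u                            ≡⟨ p≡p-0 _ ⟩
      cover (pointMass e) u - 0ℚ                       ∎)
      where open ≡-Reasoning
    bounded : total (pointMass e) - 0ℚ * c ≤ w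
    bounded = ≤-reflexive (sym (trans (p≡p-0*c w c)
                (cong (λ t → t - 0ℚ * c) (sym (sumSubsets-pointMass (invEdge H) e)))))

  weightConstraint : Constraint Derivable
  weightConstraint = constraint (χ (- 1ℚ) full) (- c)
    (derivation (λ _ → 0ℚ) 1ℚ (λ _ → ≤-refl) (≤ᵇ⇒≤ _) dominated bounded)
    where
    dominated : ∀ u → lookup (χ (- 1ℚ) full) u ≤ cover (λ _ → 0ℚ) u - 1ℚ
    dominated u = ≤-reflexive (begin
      lookup (χ (- 1ℚ) full) u           ≡⟨ lookup-map u _ full ⟩
      onlyIf (lookup full u) (- 1ℚ)      ≡⟨ cong (λ b → onlyIf b (- 1ℚ)) (lookup∘tabulate _ u) ⟩
      0ℚ - 1ℚ                            ≡⟨ cong (_- 1ℚ) (sym (cover-0 u)) ⟩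
      cover (λ _ → 0ℚ) u - 1ℚ            ∎)
      where open ≡-Reasoning
    bounded : total (λ _ → 0ℚ) - 1ℚ * c ≤ - c
    bounded = ≤-reflexive (sym (trans (-c≡0-1*c c) (cong (λ t → t - 1ℚ * c) (sym total-0))))

  vertexConstraints edgeConstraints constraints : List (Constraint Derivable)
  vertexConstraints = List.map vertexConstraint (List.allFin n)
  edgeConstraints   = List.map edgeConstraint (allSubsets n)
  constraints       = vertexConstraints ++ edgeConstraints ++ weightConstraint ∷ []

  solution⇒heavyIndep : Solvable constraints → Σ (FracIndep H) λ m → c ≤ weight m
  solution⇒heavyIndep (x , sat) = record { μ = μ ; nonneg = nonneg ; packed = packed } , heavy
    where
    μ : Fin n → ℚ
    μ = lookup x
    sat′ : All (x ⊨_) (edgeConstraints ++ weightConstraint ∷ [])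
    sat′ = All.++⁻ʳ vertexConstraints sat
    nonneg : ∀ v → 0ℚ ≤ μ v
    nonneg v = -1*p≤-q⇒q≤p (subst (_≤ 0ℚ) (trans (·-χ (- 1ℚ) ⁅ v ⁆ x) (cong (- 1ℚ *_) (sumFin-⁅⁆ v μ)))
                 (All.lookup (All.map⁻ (All.++⁻ˡ vertexConstraints sat)) (∈-allFin v)))
    packed : ∀ e → invEdge H e ≡ true → sumFin e μ ≤ 1ℚ
    packed e inv = subst₂ _≤_ (trans (·-χ w e x) (trans (cong (_* sumFin e μ) w≡1) (*-identityˡ _))) w≡1
                     (All.lookup (All.map⁻ (All.++⁻ˡ edgeConstraints sat′)) (∈-allSubsets e))
      where
      w : ℚ
      w = onlyIf (invEdge H e) 1ℚ
      w≡1 : w ≡ 1ℚ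
      w≡1 = cong (λ b → onlyIf b 1ℚ) inv
    heavy : c ≤ sumFin full μ
    heavy = -1*p≤-q⇒q≤p (subst (_≤ - c) (·-χ (- 1ℚ) full x) (All.head (All.++⁻ʳ edgeConstraints sat′)))

  -- A refutation 0 · μ ≤ b < 0 gives total ξ < s · c, so s > 0 and ξ / s covers with weight ≤ c.
  refutation⇒cover : Refutable Derivable → FracCover H full c
  refutation⇒cover (b , b<0 , derivation ξ s ξ≥0 s≥0 dom bnd) with 0ℚ <? s
  ... | no s≯0 = ⊥-elim (<-irrefl refl (≤-<-trans total≥0 (≤-<-trans bnd b<0)))
    where
    s≡0 : s ≡ 0ℚ
    s≡0 = ≤-antisym (≮⇒≥ s≯0) s≥0
    total≥0 : 0ℚ ≤ total ξ - s * c
    total≥0 = subst (0ℚ ≤_) (trans (p≡p-0*c (total ξ) c) (cong (λ s → total ξ - s * c) (sym s≡0)))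
                (sumSubsets-nonneg (invEdge H) ξ ξ≥0)
  ... | yes s>0 = record
    { ξ = λ e → r * ξ e
    ; nonneg = λ e → *-nonNeg r≥0 (ξ≥0 e)
    ; covers = λ v _ → subst₂ _≤_ (*-inverseˡ s) (sym (sumSubsets-* (covering v) r ξ))
                         (*-monoˡ-≤-0≤ r r≥0 (s≤cover v))
    ; total≤ = subst₂ _≤_ (sym (sumSubsets-* (invEdge H) r ξ)) r*[s*c]≡c
                 (*-monoˡ-≤-0≤ r r≥0 (<⇒≤ (p-q<0⇒p<q (≤-<-trans bnd b<0))))
    }
    where
    instance
      s≢0 : NonZero s
      s≢0 = >-nonZero s>0
      1/s>0 : Positive (1/ s)
      1/s>0 = 1/pos⇒pos s {{positive s>0}}
    r : ℚ
    r = 1/ s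
    r≥0 : 0ℚ ≤ r
    r≥0 = <⇒≤ (positive⁻¹ r)
    s≤cover : ∀ v → s ≤ cover ξ v
    s≤cover v = 0≤p-q⇒q≤p (subst (_≤ cover ξ v - s) (lookup-replicate v 0ℚ) (dom v))
    r*[s*c]≡c : r * (s * c) ≡ c
    r*[s*c]≡c = trans (sym (*-assoc r s c)) (trans (cong (_* c) (*-inverseˡ s)) (*-identityˡ c))

fracCover⊎heavyIndep : ∀ {n} (H : Hypergraph n) c →
                       ρ*V≤ H c ⊎ Σ (FracIndep H) λ m → c ≤ weight m
fracCover⊎heavyIndep H c = [ inj₂ ∘ solution⇒heavyIndep , inj₁ ∘ refutation⇒cover ]′
                             (fourierMotzkin conic constraints)
  where open CoverLP H c

weight<⇒ρ*V≤ : ∀ {n} (H : Hypergraph n) c → (∀ (m : FracIndep H) → weight m < c) → ρ*V≤ H c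
weight<⇒ρ*V≤ H c light = [ id , (λ (m , heavy) → ⊥-elim (<-irrefl refl (<-≤-trans (light m) heavy))) ]′
                           (fracCover⊎heavyIndep H c)

∈⇒lookup : ∀ {n} {v : Fin n} {S} → v ∈ S → lookup S v ≡ true
∈⇒lookup = []=⇒lookup

lookup⇒∈ : ∀ {n} {v : Fin n} {S} → lookup S v ≡ true → v ∈ S
lookup⇒∈ {v = v} {S} = lookup⇒[]= v S

∈-tabulate⁻ : ∀ {n} {p : Fin n → Bool} {v} → v ∈ tabulate p → p v ≡ true
∈-tabulate⁻ {p = p} {v} v∈ = trans (sym (lookup∘tabulate p v)) (∈⇒lookup v∈)

∈full : ∀ {n} (v : Fin n) → v ∈ full
∈full v = lookup⇒∈ (lookup∘tabulate _ v)

anyFin-true : ∀ {n} (f : Fin n → Bool) i → f i ≡ true → anyFin f ≡ true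
anyFin-true f zero    fi = cong (_∨ anyFin (λ j → f (suc j))) fi
anyFin-true f (suc i) fi =
  trans (cong (f zero ∨_) (anyFin-true (λ j → f (suc j)) i fi)) (∨-zeroʳ (f zero))

allFin-true : ∀ {n} (f : Fin n → Bool) → (∀ i → f i ≡ true) → allFin f ≡ true
allFin-true {zero}  f _  = refl
allFin-true {suc n} f all =
  trans (cong (_∧ allFin (λ i → f (suc i))) (all zero)) (allFin-true (λ i → f (suc i)) (λ i → all (suc i)))

isYes-≟-refl : ∀ {k} (j : Fin k) → isYes (j ≟ j) ≡ true
isYes-≟-refl j with j ≟ j
... | yes _   = refl
... | no j≢j = contradiction refl j≢j

∣p∣≡0⇒p≡⊥ : ∀ {n} (p : Subset n) → ∣ p ∣ ≡ 0 → p ≡ ⊥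
∣p∣≡0⇒p≡⊥ []          _  = refl
∣p∣≡0⇒p≡⊥ (false ∷ p) eq = cong (false ∷_) (∣p∣≡0⇒p≡⊥ p eq)

∣p∣≡1⇒p≡⁅x⁆ : ∀ {n} (p : Subset n) → ∣ p ∣ ≡ 1 → ∃ λ x → p ≡ ⁅ x ⁆
∣p∣≡1⇒p≡⁅x⁆ (true ∷ p)  eq = zero , cong (true ∷_) (∣p∣≡0⇒p≡⊥ p (cong ℕ.pred eq))
∣p∣≡1⇒p≡⁅x⁆ (false ∷ p) eq with ∣p∣≡1⇒p≡⁅x⁆ p eq
... | x , refl = suc x , refl

x∈p⇒⁅x⁆⊆p : ∀ {n} {x : Fin n} {p} → x ∈ p → ⁅ x ⁆ ⊆ p
x∈p⇒⁅x⁆⊆p {x = x} x∈p y∈⁅x⁆ rewrite x∈⁅y⁆⇒x≡y x y∈⁅x⁆ = x∈p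

edge⇒invEdge : ∀ {n} (H : Hypergraph n) {e} → edge H e ≡ true → invEdge H e ≡ true
edge⇒invEdge H e∈H rewrite e∈H = refl

invEdge⇒edge⊎singleton : ∀ {n} (H : Hypergraph n) {e} → invEdge H e ≡ true →
                         edge H e ≡ true ⊎ ∃ λ v → e ≡ ⁅ v ⁆
invEdge⇒edge⊎singleton H {e} inv with edge H e in e∈H
... | true  = inj₁ refl
... | false = inj₂ (∣p∣≡1⇒p≡⁅x⁆ e (ℕ.≡ᵇ⇒≡ ∣ e ∣ 1 (Equivalence.from T-≡ (∧-conicalˡ _ _ inv))))

vertex∈invEdge : ∀ {n} (H : Hypergraph n) v → Σ (Subset n) λ e → invEdge H e ≡ true × v ∈ e
vertex∈invEdge {n} H v with any (λ e → edge H e ∧ lookup e v) (allSubsets n) in incident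
... | false = ⁅ v ⁆ , singleton-inv , x∈⁅x⁆ v
  where
  isolated-v : isolated H v ≡ true
  isolated-v = cong not incident
  others : ∀ u → (not (lookup ⁅ v ⁆ u) ∨ isolated H u) ≡ true
  others u with lookup ⁅ v ⁆ u in u∈⁅v⁆
  ... | false = refl
  ... | true rewrite x∈⁅y⁆⇒x≡y v (lookup⇒∈ u∈⁅v⁆) = isolated-v
  singleton-inv : invEdge H ⁅ v ⁆ ≡ true
  singleton-inv rewrite ∣⁅x⁆∣≡1 v | allFin-true _ others = ∨-zeroʳ (edge H ⁅ v ⁆)
... | true with satisfied (any⁻ _ (allSubsets n) (Equivalence.from T-≡ incident))
...   | e , e∈H∧v∈e = e , edge⇒invEdge H (∧-conicalˡ _ _ e∈H∧v∈e′) , lookup⇒∈ (∧-conicalʳ _ _ e∈H∧v∈e′)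
  where
  e∈H∧v∈e′ : (edge H e ∧ lookup e v) ≡ true
  e∈H∧v∈e′ = Equivalence.to T-≡ e∈H∧v∈e

module _ {n} {H : Hypergraph n} (m : FracIndep H) where
  open FracIndep m

  packed-⊆ : ∀ {S e} → S ⊆ e → invEdge H e ≡ true → sumFin S μ ≤ 1ℚ
  packed-⊆ S⊆e inv = ≤-trans (sumFin-mono-⊆ nonneg S⊆e) (packed _ inv)

  packed-⁅⁆ : ∀ v → sumFin ⁅ v ⁆ μ ≤ 1ℚ
  packed-⁅⁆ v with vertex∈invEdge H v
  ... | e , inv , v∈e = packed-⊆ (x∈p⇒⁅x⁆⊆p v∈e) inv

  μ≤1 : ∀ v → μ v ≤ 1ℚ
  μ≤1 v = subst (_≤ 1ℚ) (sumFin-⁅⁆ v μ) (packed-⁅⁆ v)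

preimage : ∀ {n k} → (Fin k → Fin n) → Subset n → Subset k
preimage f e = tabulate (λ j → lookup e (f j))

weakDuality : ∀ {n k} {H : Hypergraph n} {c} → ρ*V≤ H c →
              (μ : Fin k → ℚ) → (∀ j → 0ℚ ≤ μ j) → (f : Fin k → Fin n) →
              (∀ e → invEdge H e ≡ true → sumFin (preimage f e) μ ≤ 1ℚ) →
              sumFin full μ ≤ c
weakDuality {H = H} {c} cover μ μ≥0 f packed = begin
  sumFin full μ
    ≤⟨ sumFin-mono full μ≤μ*cover ⟩
  sumFin full (λ j → μ j * cov (f j))
    ≡⟨ sumFin-cong full unfold ⟩
  sumFin full (λ j → sumSubsets (invEdge H) (λ e → μ j * onlyIf (lookup e (f j)) (ξ e)))
    ≡⟨ sumFin-sumSubsets full (invEdge H) (λ j e → μ j * onlyIf (lookup e (f j)) (ξ e)) ⟩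
  sumSubsets (invEdge H) (λ e → sumFin full (λ j → μ j * onlyIf (lookup e (f j)) (ξ e)))
    ≡⟨ sumSubsets-cong (invEdge H) (λ e → sumFin-tabulate (λ j → lookup e (f j)) μ (ξ e)) ⟩
  sumSubsets (invEdge H) (λ e → sumFin (preimage f e) μ * ξ e)
    ≤⟨ sumSubsets-mono (invEdge H) _ ξ load≤ξ ⟩
  sumSubsets (invEdge H) ξ
    ≤⟨ total≤ ⟩
  c ∎
  where
  open FracCover cover
  open ≤-Reasoning
  cov : Fin _ → ℚ
  cov v = sumSubsets (λ e → invEdge H e ∧ lookup e v) ξ
  μ≤μ*cover : ∀ j → μ j ≤ μ j * cov (f j)
  μ≤μ*cover j = subst (_≤ μ j * cov (f j)) (*-identityʳ (μ j))
                  (*-monoˡ-≤-0≤ (μ j) (μ≥0 j) (covers (f j) (∈full (f j))))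
  unfold : ∀ j → μ j * cov (f j) ≡ sumSubsets (invEdge H) (λ e → μ j * onlyIf (lookup e (f j)) (ξ e))
  unfold j = trans (cong (μ j *_) (sumSubsets-∧ (invEdge H) (λ e → lookup e (f j)) ξ))
                  (sym (sumSubsets-* (invEdge H) (μ j) _))
  load≤ξ : ∀ e → invEdge H e ≡ true → sumFin (preimage f e) μ * ξ e ≤ ξ e
  load≤ξ e inv = subst (sumFin (preimage f e) μ * ξ e ≤_) (*-identityˡ (ξ e))
                   (*-monoʳ-≤-nonNeg (ξ e) {{nonNegative (nonneg e)}} (packed e inv))

quotient-weight≤ : ∀ {n k} {H H′ : Hypergraph n} {π : Fin n → Fin k} {F : Hypergraph k} {c} →
                   ρ*V≤ H c → (∀ e → edge H e ≡ true → edge H′ e ≡ true) → IsQuotient H′ π F →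
                   (m : FracIndep F) → weight m ≤ c
quotient-weight≤ {H = H} {π = π} {F} cover H⊆H′ (surjective , _ , image-edge) m =
  weakDuality cover μ nonneg rep packed-preimage
  where
  open FracIndep m
  rep : Fin _ → Fin _
  rep j = proj₁ (surjective j)
  π∘rep : ∀ j → π (rep j) ≡ j
  π∘rep j = proj₂ (surjective j)
  preimage⊆image : ∀ e → preimage rep e ⊆ image π e
  preimage⊆image e {j} j∈ = lookup⇒∈ (trans (lookup∘tabulate _ j) (anyFin-true _ (rep j) rep-j-hits))
    where
    rep-j-hits : (lookup e (rep j) ∧ isYes (π (rep j) ≟ j)) ≡ true
    rep-j-hits = cong₂ _∧_ (∈-tabulate⁻ j∈) (trans (cong (λ i → isYes (i ≟ j)) (π∘rep j)) (isYes-≟-refl j))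
  preimage⁅⁆⊆⁅π⁆ : ∀ v → preimage rep ⁅ v ⁆ ⊆ ⁅ π v ⁆
  preimage⁅⁆⊆⁅π⁆ v {j} j∈ = subst (_∈ ⁅ π v ⁆) (sym j≡πv) (x∈⁅x⁆ (π v))
    where
    j≡πv : j ≡ π v
    j≡πv = trans (sym (π∘rep j)) (cong π (x∈⁅y⁆⇒x≡y v (lookup⇒∈ (∈-tabulate⁻ j∈))))
  packed-preimage : ∀ e → invEdge H e ≡ true → sumFin (preimage rep e) μ ≤ 1ℚ
  packed-preimage e inv with invEdge⇒edge⊎singleton H inv
  ... | inj₁ e∈H       = packed-⊆ m (preimage⊆image e) (edge⇒invEdge F (image-edge e (H⊆H′ e e∈H)))
  ... | inj₂ (v , refl) = ≤-trans (sumFin-mono-⊆ nonneg (preimage⁅⁆⊆⁅π⁆ v)) (packed-⁅⁆ m (π v))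

trivialDecomp : ∀ {n} (H : Hypergraph n) → TreeDecomp H (node full [])
trivialDecomp H = record
  { coversV = λ v → here (∈full v)
  ; coversE = λ _ _ → here (λ {v} _ → ∈full v)
  ; conn    = λ v → inside (∈full v) [] []
  }

boundedρ*⇒boundedFHW : (𝓗 : Class) → BoundedFracEdgeCover 𝓗 → BoundedFHW (𝒬 (𝒮 𝓗))
boundedρ*⇒boundedFHW 𝓗 (N , bounded) = suc N , oneBag
  where
  oneBag : ∀ k F → 𝒬 (𝒮 𝓗) k F →
            Σ (Tree (Subset k)) λ T → TreeDecomp F T × AllBags (λ B → ρ*≤ F B (fromℕ (suc N))) T
  oneBag k F (n , H′ , π , (H , H∈𝓗 , H⊆H′) , quotient) =
    node full [] , trivialDecomp F , node (weight<⇒ρ*V≤ F _ light) []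
    where
    light : ∀ (m : FracIndep F) → weight m < fromℕ (suc N)
    light m = subst (weight m <_) (sym (fromℕ-+ 1 N))
                (≤-<-trans (quotient-weight≤ {H′ = H′} (bounded n H H∈𝓗) H⊆H′ quotient m)
                           (x<1+x (fromℕ N)))

-- The Helly property of subtrees

module _ {A : Set} where

  mutual
    AnyBag-map : ∀ {P Q : A → Set} → (∀ {B} → P B → Q B) → ∀ {T} → AnyBag P T → AnyBag Q T
    AnyBag-map f (here p)   = here (f p)
    AnyBag-map f (there ps) = there (AnyBags-map f ps)

    AnyBags-map : ∀ {P Q : A → Set} → (∀ {B} → P B → Q B) →
                  ∀ {ts} → Any (AnyBag P) ts → Any (AnyBag Q) ts
    AnyBags-map f (here p)   = here (AnyBag-map f p)
    AnyBags-map f (there ps) = there (AnyBags-map f ps)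

  mutual
    AllBags-AnyBag : ∀ {P Q : A → Set} {T} → AllBags P T → AnyBag Q T → ∃ λ B → P B × Q B
    AllBags-AnyBag (node p _)  (here q)   = _ , p , q
    AllBags-AnyBag (node _ ps) (there qs) = AllBags-AnyBags ps qs

    AllBags-AnyBags : ∀ {P Q : A → Set} {ts} → All (AllBags P) ts → Any (AnyBag Q) ts →
                      ∃ λ B → P B × Q B
    AllBags-AnyBags (p ∷ _)  (here q)   = AllBags-AnyBag p q
    AllBags-AnyBags (_ ∷ ps) (there qs) = AllBags-AnyBags ps qs

  AnyBag-root : ∀ {P : A → Set} (T : Tree A) → P (root T) → AnyBag P T
  AnyBag-root (node _ _) p = here p

  AnyBag-child : ∀ {P : A → Set} {b ts} → ¬ P b → AnyBag P (node b ts) → ∃ λ c → c ∈ₗ ts × AnyBag P c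
  AnyBag-child ¬Pb (here Pb)  = contradiction Pb ¬Pb
  AnyBag-child ¬Pb (there ps) = find ps

AllPairs-unique : ∀ {A : Set} {R : A → Set} {xs : List A} {x y} →
                  AllPairs (λ x y → ¬ (R x × R y)) xs → x ∈ₗ xs → y ∈ₗ xs → R x → R y → x ≡ y
AllPairs-unique (_ ∷ _)  (here refl) (here refl) _  _  = refl
AllPairs-unique (h ∷ _)  (here refl) (there y∈) Rx Ry = contradiction (Rx , Ry) (All.lookup h y∈)
AllPairs-unique (h ∷ _)  (there x∈) (here refl) Rx Ry = contradiction (Ry , Rx) (All.lookup h x∈)
AllPairs-unique (_ ∷ hs) (there x∈) (there y∈) Rx Ry = AllPairs-unique hs x∈ y∈ Rx Ry

module _ {n : ℕ} where

  Conn-children : ∀ {v : Fin n} {b ts} → Conn v (node b ts) → All (Conn v) ts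
  Conn-children (inside  _ _ cs) = cs
  Conn-children (outside _ _ cs) = cs

  Conn-inside : ∀ {v : Fin n} {b ts} → v ∈ b → Conn v (node b ts) →
                All (λ c → AnyBag (v ∈_) c → v ∈ root c) ts
  Conn-inside _   (inside _ down _)  = down
  Conn-inside v∈b (outside v∉b _ _) = contradiction v∈b v∉b

  Conn-outside : ∀ {v : Fin n} {b ts} → v ∉ b → Conn v (node b ts) →
                 AllPairs (λ c d → ¬ (AnyBag (v ∈_) c × AnyBag (v ∈_) d)) ts
  Conn-outside v∉b (inside v∈b _ _) = contradiction v∈b v∉b
  Conn-outside _   (outside _ apart _) = apart

  Shares : Fin n → Fin n → Subset n → Set
  Shares u w B = u ∈ B × w ∈ B

  PairwiseShared : Tree (Subset n) → Set
  PairwiseShared T = (∀ v → Conn v T) × (∀ u w → AnyBag (Shares u w) T)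

  descend : ∀ {b ts} → PairwiseShared (node b ts) → ∀ {v} → v ∉ b →
            ∃ λ c → c ∈ₗ ts × PairwiseShared c
  descend {b} {ts} (conn , shared) {v} v∉b with AnyBag-child (λ vv∈b → v∉b (proj₁ vv∈b)) (shared v v)
  ... | c , c∈ts , vv∈c = c , c∈ts , (λ u → All.lookup (Conn-children (conn u)) c∈ts) , sharedBelow
    where
    unique : ∀ {x d} → x ∉ b → d ∈ₗ ts → AnyBag (x ∈_) d → AnyBag (x ∈_) c → d ≡ c
    unique x∉b d∈ts x∈d x∈c = AllPairs-unique (Conn-outside x∉b (conn _)) d∈ts c∈ts x∈d x∈c
    below : ∀ u → AnyBag (u ∈_) c
    below u with AnyBag-child (λ uv∈b → v∉b (proj₂ uv∈b)) (shared u v)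
    ... | d , d∈ts , uv∈d =
      subst (AnyBag (u ∈_)) (unique v∉b d∈ts (AnyBag-map proj₂ uv∈d) (AnyBag-map proj₁ vv∈c))
        (AnyBag-map proj₁ uv∈d)
    via : ∀ u w {x} → x ∉ b → (∀ {B} → Shares u w B → x ∈ B) → AnyBag (Shares u w) c
    via u w x∉b pick with AnyBag-child (λ uw∈b → x∉b (pick uw∈b)) (shared u w)
    ... | d , d∈ts , uw∈d =
      subst (AnyBag (Shares u w)) (unique x∉b d∈ts (AnyBag-map pick uw∈d) (below _)) uw∈d
    sharedBelow : ∀ u w → AnyBag (Shares u w) c
    sharedBelow u w with u ∈? b | w ∈? b
    ... | no u∉b  | _       = via u w u∉b proj₁
    ... | yes _   | no w∉b  = via u w w∉b proj₂
    ... | yes u∈b | yes w∈b = AnyBag-root c (atRoot u∈b , atRoot w∈b)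
      where
      atRoot : ∀ {x} → x ∈ b → x ∈ root c
      atRoot x∈b = All.lookup (Conn-inside x∈b (conn _)) c∈ts (below _)

  mutual
    helly : ∀ T → PairwiseShared T → AnyBag (λ B → ∀ v → v ∈ B) T
    helly (node b ts) hyp with all? (_∈? b)
    ... | yes full∈b = here full∈b
    ... | no ¬full∈b with ¬∀⟶∃¬ n (_∈ b) (_∈? b) ¬full∈b
    ...   | v , v∉b with descend hyp v∉b
    ...     | c , c∈ts , hypc = there (helly-child ts c∈ts hypc)

    helly-child : ∀ ts {c} → c ∈ₗ ts → PairwiseShared c → Any (AnyBag (λ B → ∀ v → v ∈ B)) ts
    helly-child (t ∷ _)  (here refl) hyp = here (helly t hyp)
    helly-child (_ ∷ ts) (there c∈) hyp = there (helly-child ts c∈ hyp)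

-- Adding every edge with one or two vertices

∣p∪q∣≤∣p∣+∣q∣ : ∀ {n} (p q : Subset n) → ∣ p ∪ q ∣ ℕ.≤ ∣ p ∣ ℕ.+ ∣ q ∣
∣p∪q∣≤∣p∣+∣q∣ []          []          = z≤n
∣p∪q∣≤∣p∣+∣q∣ (true  ∷ p) (y ∷ q)     =
  s≤s (ℕ.≤-trans (∣p∪q∣≤∣p∣+∣q∣ p q) (ℕ.+-monoʳ-≤ ∣ p ∣ (∣p∣≤∣x∷p∣ y q)))
∣p∪q∣≤∣p∣+∣q∣ (false ∷ p) (true  ∷ q) =
  subst (suc ∣ p ∪ q ∣ ℕ.≤_) (sym (ℕ.+-suc ∣ p ∣ ∣ q ∣)) (s≤s (∣p∪q∣≤∣p∣+∣q∣ p q))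
∣p∪q∣≤∣p∣+∣q∣ (false ∷ p) (false ∷ q) = ∣p∪q∣≤∣p∣+∣q∣ p q

1≤∣p∣⇒nonempty : ∀ {n} (p : Subset n) → 1 ℕ.≤ ∣ p ∣ → Nonempty p
1≤∣p∣⇒nonempty {n} p 1≤∣p∣ with nonempty? p
... | yes nonempty = nonempty
... | no  empty    =
  contradiction (subst (1 ℕ.≤_) (trans (cong ∣_∣ (Empty-unique empty)) (∣⊥∣≡0 n)) 1≤∣p∣) λ ()

isSmall : ∀ {n} → Subset n → Bool
isSmall e = (1 ≤ᵇ ∣ e ∣) ∧ (∣ e ∣ ≤ᵇ 2)

withPairs : ∀ {n} → Hypergraph n → Hypergraph n
withPairs H = record { edge = λ e → edge H e ∨ isSmall e ; nonempty = nonempty′ }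
  where
  nonempty′ : ∀ e → (edge H e ∨ isSmall e) ≡ true → Nonempty e
  nonempty′ e e∈ with edge H e in e∈H
  ... | true  = nonempty H e e∈H
  ... | false = 1≤∣p∣⇒nonempty e (ℕ.≤ᵇ⇒≤ 1 ∣ e ∣ (Equivalence.from T-≡ (∧-conicalˡ _ _ e∈)))

pair∈withPairs : ∀ {n} (H : Hypergraph n) u w → edge (withPairs H) (⁅ u ⁆ ∪ ⁅ w ⁆) ≡ true
pair∈withPairs H u w = trans (cong (edge H (⁅ u ⁆ ∪ ⁅ w ⁆) ∨_) small) (∨-zeroʳ _)
  where
  lower : 1 ℕ.≤ ∣ ⁅ u ⁆ ∪ ⁅ w ⁆ ∣
  lower = subst (ℕ._≤ ∣ ⁅ u ⁆ ∪ ⁅ w ⁆ ∣) (∣⁅x⁆∣≡1 u) (∣p∣≤∣p∪q∣ ⁅ u ⁆ ⁅ w ⁆)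
  upper : ∣ ⁅ u ⁆ ∪ ⁅ w ⁆ ∣ ℕ.≤ 2
  upper = subst (∣ ⁅ u ⁆ ∪ ⁅ w ⁆ ∣ ℕ.≤_) (cong₂ ℕ._+_ (∣⁅x⁆∣≡1 u) (∣⁅x⁆∣≡1 w))
                (∣p∪q∣≤∣p∣+∣q∣ ⁅ u ⁆ ⁅ w ⁆)
  small : isSmall (⁅ u ⁆ ∪ ⁅ w ⁆) ≡ true
  small = Equivalence.to T-≡ (Equivalence.from T-∧ (ℕ.≤⇒≤ᵇ lower , ℕ.≤⇒≤ᵇ upper))

fromℕ*½≤1 : ∀ k → k ℕ.≤ 2 → fromℕ k * ½ ≤ 1ℚ
fromℕ*½≤1 0 _ = ≤ᵇ⇒≤ _
fromℕ*½≤1 1 _ = ≤ᵇ⇒≤ _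
fromℕ*½≤1 2 _ = ≤ᵇ⇒≤ _
fromℕ*½≤1 (suc (suc (suc _))) (s≤s (s≤s ()))

halve : ∀ {n} {H : Hypergraph n} → FracIndep H → FracIndep (withPairs H)
halve {H = H} m = record { μ = μ/2 ; nonneg = λ v → *-nonNeg (nonneg v) ½≥0 ; packed = packed′ }
  where
  open FracIndep m
  μ/2 : Fin _ → ℚ
  μ/2 v = μ v * ½
  ½≥0 : 0ℚ ≤ ½
  ½≥0 = ≤ᵇ⇒≤ _
  μ/2≤½ : ∀ v → μ/2 v ≤ ½
  μ/2≤½ v = subst (μ/2 v ≤_) (*-identityˡ ½) (*-monoʳ-≤-nonNeg ½ (μ≤1 m v))
  small-packed : ∀ e → ∣ e ∣ ℕ.≤ 2 → sumFin e μ/2 ≤ 1ℚ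
  small-packed e ∣e∣≤2 = ≤-trans (sumFin-≤-∣∣* e μ/2≤½) (fromℕ*½≤1 ∣ e ∣ ∣e∣≤2)
  packed′ : ∀ e → invEdge (withPairs H) e ≡ true → sumFin e μ/2 ≤ 1ℚ
  packed′ e inv with invEdge⇒edge⊎singleton (withPairs H) inv
  ... | inj₂ (v , refl) = small-packed ⁅ v ⁆ (subst (ℕ._≤ 2) (sym (∣⁅x⁆∣≡1 v)) (s≤s z≤n))
  ... | inj₁ e∈H′ with edge H e in e∈H
  ...   | true  = subst (_≤ 1ℚ) (sym (sumFin-*ʳ e μ ½))
                    (≤-trans (*-monoʳ-≤-nonNeg ½ (packed e (edge⇒invEdge H e∈H))) (≤ᵇ⇒≤ _))
  ...   | false = small-packed e (ℕ.≤ᵇ⇒≤ ∣ e ∣ 2 (Equivalence.from T-≡ (∧-conicalʳ _ _ e∈H′)))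

H⊆withPairs : ∀ {n} (H : Hypergraph n) e → edge H e ≡ true → edge (withPairs H) e ≡ true
H⊆withPairs H e e∈H = cong (_∨ isSmall e) e∈H

withPairs-fullBag : ∀ {n} {H : Hypergraph n} {T} → TreeDecomp (withPairs H) T →
                    AnyBag (λ B → ∀ v → v ∈ B) T
withPairs-fullBag {H = H} {T} decomposition = helly T (conn , pairShared)
  where
  open TreeDecomp decomposition
  pairShared : ∀ u w → AnyBag (Shares u w) T
  pairShared u w = AnyBag-map (λ pair⊆B → pair⊆B u∈pair , pair⊆B w∈pair)
                     (coversE (⁅ u ⁆ ∪ ⁅ w ⁆) (pair∈withPairs H u w))
    where
    u∈pair : u ∈ ⁅ u ⁆ ∪ ⁅ w ⁆
    u∈pair = x∈p∪q⁺ (inj₁ (x∈⁅x⁆ u))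
    w∈pair : w ∈ ⁅ u ⁆ ∪ ⁅ w ⁆
    w∈pair = x∈p∪q⁺ (inj₂ (x∈⁅x⁆ w))

weight≤N+N : ∀ {n} {H : Hypergraph n} (m : FracIndep H) {T} {N} → TreeDecomp (withPairs H) T →
            AllBags (λ B → sumFin B (FracIndep.μ (halve m)) ≤ N) T → weight m ≤ N + N
weight≤N+N m {N = N} decomposition bags≤N with AllBags-AnyBag bags≤N (withPairs-fullBag decomposition)
... | B , B≤N , B-full = subst (_≤ N + N) (halves (weight m)) (+-mono-≤ half≤N half≤N)
  where
  open FracIndep (halve m)
  half≤N : weight m * ½ ≤ N
  half≤N = subst (_≤ N) (sumFin-*ʳ full (FracIndep.μ m) ½)
             (≤-trans (sumFin-mono-⊆ nonneg (λ {v} _ → B-full v)) B≤N)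
  halves : ∀ p → p * ½ + p * ½ ≡ p
  halves = solve-∀ ℚ-ring

boundedAdw⇒boundedρ* : (𝓗 : Class) → BoundedAdaptiveWidth (𝒮 𝓗) → BoundedFracEdgeCover 𝓗
boundedAdw⇒boundedρ* 𝓗 (N , adw) = suc (N ℕ.+ N) , λ n H H∈𝓗 → weight<⇒ρ*V≤ H _ (light n H H∈𝓗)
  where
  light : ∀ n H → 𝓗 n H → (m : FracIndep H) → weight m < fromℕ (suc (N ℕ.+ N))
  light n H H∈𝓗 m with adw n (withPairs H) (H , H∈𝓗 , H⊆withPairs H) (halve m)
  ... | _ , decomposition , bags≤N =
    subst (weight m <_) (sym (trans (fromℕ-+ 1 (N ℕ.+ N)) (cong (1ℚ +_) (fromℕ-+ N N))))
      (≤-<-trans (weight≤N+N m decomposition bags≤N) (x<1+x _))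

lemma2p6 : (𝓗 : Class) →
    (BoundedFracEdgeCover 𝓗 → BoundedFHW (𝒬 (𝒮 𝓗))) ×
    (¬ BoundedFracEdgeCover 𝓗 → ¬ BoundedAdaptiveWidth (𝒮 𝓗))
lemma2p6 𝓗 = boundedρ*⇒boundedFHW 𝓗 , λ unbounded adw → unbounded (boundedAdw⇒boundedρ* 𝓗 adw)
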